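{- Let $i$ be an integer and let $G$ be an isometric subgraph of $\mathcal{F}_i$ with $|V(G)|\ge 2$, and put $S=V(G)$. Then there exist at least two (distinct) vertices $u_{+},u_{ - }\in S$ each of which satisfies the following two conditions (with $p=u_+$ resp. $p=u_-$): (I) the induced subgraph $\mathcal{F}[M_S(p)]$ is connected; (II) $|N_S^0(p)|\le 2$.
   Context: The face-centered cubic grid $\mathcal{F}$ is the graph with vertex set $\{(i,j,k): i,j\in\mathbb{Z},\ k \text{ even}\}\cup\{(i+\tfrac12,j+\tfrac12,k): i,j\in\mathbb{Z},\ k\text{ odd}\}$, in which $(i,j,k)$ and $(i',j',k')$ are adjacent iff ($|i-i'|=1$, $j=j'$, $k=k'$) or ($i=i'$, $|j-j'|=1$, $k=k'$) or ($|i-i'|=|j-j'|=\tfrac12$ and $|k-k'|=1$). Layer $k$ is the set of vertices with third coordinate $k$, and $\mathcal{F}_k$ is the subgraph of $\mathcal{F}$ induced by layer $k$ (a square grid). For $S\subseteq V(\mathcal{F})$, $\mathcal{F}[S]$ is the induced subgraph. For $p\in S$, $N_S^0(p)$ is the set of neighbors of $p$ in $\mathcal{F}$ that lie in $S$ and in the same layer as $p$. The corners of $p=(i,j,k)$ are the four vertices $(i\pm1,j\pm1,k)$, forming the set $C(p)$, and the extended neighborhood is $M_S(p)=N_S^0(p)\cup (C(p)\cap S)$. A subgraph $G$ of $\mathcal{F}_i$ is isometric if $d_G(u,v)=d_{\mathcal{F}_i}(u,v)$ for all $u,v\in V(G)$ (in particular $G$ is connected). -}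

module Defs where

open import Data.Nat using (ℕ; zero; suc; _≤_)
import Data.Nat as ℕ
open import Data.Integer using (ℤ; +_; _-_; ∣_∣)
import Data.Integer as ℤ
open import Data.Integer.Divisibility using (_∣_)
open import Data.Product using (_×_; _,_; ∃)
open import Data.Sum using (_⊎_)
open import Data.List using (List; filter; length)
open import Data.List.Membership.Propositional using (_∈_)
open import Relation.Binary.PropositionalEquality using (_≡_)
open import Relation.Nullary using (Dec)
open import Relation.Nullary.Decidable using (_×-dec_; _⊎-dec_)

-- Vertices of the FCC grid in DOUBLED planar coordinates:
-- the vertex with real coordinates (x, y, k) is stored as (X, Y, k) = (2x, 2y, k).
-- Thus (i,j,k), k even, gives X,Y even; (i+1/2, j+1/2, k), k odd, gives X,Y odd.
record Vertex : Set where
  constructor vtx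
  field
    X : ℤ
    Y : ℤ
    k : ℤ
    .parX : + 2 ∣ (X - k)
    .parY : + 2 ∣ (Y - k)
open Vertex public

-- Adjacency of the FCC grid (scaled by 2 in the planar coordinates):
-- (|i-i'|=1, j=j', k=k') or (i=i', |j-j'|=1, k=k') or (|i-i'|=|j-j'|=1/2, |k-k'|=1).
Adj : Vertex → Vertex → Set
Adj u v =
    (∣ X u - X v ∣ ≡ 2 × Y u ≡ Y v × k u ≡ k v)
  ⊎ (X u ≡ X v × ∣ Y u - Y v ∣ ≡ 2 × k u ≡ k v)
  ⊎ (∣ X u - X v ∣ ≡ 1 × ∣ Y u - Y v ∣ ≡ 1 × ∣ k u - k v ∣ ≡ 1)

SameLayerNbr : Vertex → Vertex → Set
SameLayerNbr p q = Adj p q × k p ≡ k q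

sameLayerNbr? : (p q : Vertex) → Dec (SameLayerNbr p q)
sameLayerNbr? p q =
  (((∣ X p - X q ∣ ℕ.≟ 2) ×-dec ((Y p ℤ.≟ Y q) ×-dec (k p ℤ.≟ k q)))
   ⊎-dec (((X p ℤ.≟ X q) ×-dec ((∣ Y p - Y q ∣ ℕ.≟ 2) ×-dec (k p ℤ.≟ k q)))
   ⊎-dec ((∣ X p - X q ∣ ℕ.≟ 1) ×-dec ((∣ Y p - Y q ∣ ℕ.≟ 1) ×-dec (∣ k p - k q ∣ ℕ.≟ 1)))))
  ×-dec (k p ℤ.≟ k q)

-- N_S^0(p) as a sublist of S (S is duplicate-free, so its length is the cardinality).
N0 : List Vertex → Vertex → List Vertex
N0 S p = filter (sameLayerNbr? p) S

-- q ∈ C(p): q = (i±1, j±1, k) for p = (i, j, k)  (doubled: X±2, Y±2).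
Corner : Vertex → Vertex → Set
Corner p q = ∣ X p - X q ∣ ≡ 2 × ∣ Y p - Y q ∣ ≡ 2 × k p ≡ k q

InM : List Vertex → Vertex → Vertex → Set
InM S p q = q ∈ S × (SameLayerNbr p q ⊎ Corner p q)

data Walk (P : Vertex → Set) (E : Vertex → Vertex → Set) : Vertex → Vertex → ℕ → Set where
  stop : ∀ {u} → P u → Walk P E u u zero
  step : ∀ {u v w n} → P u → E u v → Walk P E v w n → Walk P E u w (suc n)

Dist : (P : Vertex → Set) (E : Vertex → Vertex → Set) → Vertex → Vertex → ℕ → Set
Dist P E u v n = Walk P E u v n × (∀ m → Walk P E u v m → n ≤ m)

InducedConnected : (Vertex → Set) → Set
InducedConnected T = ∀ u v → T u → T v → ∃ λ n → Walk T Adj u v n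

InLayer : ℤ → Vertex → Set
InLayer i v = k v ≡ i

record IsometricSubgraph (i : ℤ) (S : List Vertex) (E : Vertex → Vertex → Set) : Set where
  field
    inLayer   : ∀ v → v ∈ S → InLayer i v
    edgesInS  : ∀ u v → E u v → u ∈ S × v ∈ S
    edgesAdj  : ∀ u v → E u v → Adj u v
    edgesSym  : ∀ u v → E u v → E v u
    isometric : ∀ u v → u ∈ S → v ∈ S → ∀ n →
                  (Dist (_∈ S) E u v n → Dist (InLayer i) Adj u v n)
                × (Dist (InLayer i) Adj u v n → Dist (_∈ S) E u v n)

Good : List Vertex → Vertex → Set
Good S p = InducedConnected (InM S p) × length (N0 S p) ≤ 2

-- Fix signs s, t and let p ∈ S maximise (s · X, t · Y) lexicographically.  Nothing
-- of S lies beyond p in direction s, nor beyond p in direction t within p's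
-- column, so N⁰_S(p) ⊆ {a, b} and M_S(p) ⊆ {a, b, c, d}, where a, b are the
-- inward neighbours of p, c the corner between them and d the other inward
-- corner.  In an isometric subgraph a diagonal pair u, u + (±1, ±1) forces one of
-- the two intermediate vertices into S; hence d ∈ S gives a ∈ S, c ∈ S gives
-- a ∈ S or b ∈ S, and p is good unless a, b ∈ S but c ∉ S.  This cannot happen
-- both at the top (t = +) and at the bottom (t = −) of the s-extreme column: the
-- lower a would lie strictly below the upper a in one column, and the geodesic
-- between them runs straight down that column through c.  Taking s = + and s = −
-- gives two good vertices in distinct columns; if S is a single column, its top
-- and bottom vertices are good.
module Submission where

open import Defs
open import Data.Empty using (⊥; ⊥-elim)
open import Data.Integer as ℤ
  using (ℤ; +_; -[1+_]; +[1+_]; _-_; ∣_∣; 0ℤ; 1ℤ; -1ℤ; _+_; _*_; -_)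
import Data.Integer.Divisibility as Unsigned
import Data.Integer.Divisibility.Signed as Signed
import Data.Integer.Properties as ℤP
open import Data.Integer.Tactic.RingSolver using (solve-∀)
open import Data.List using (List; []; _∷_; length)
import Data.List.Extrema
open import Data.List.Membership.Propositional using (_∈_; _∉_)
open import Data.List.Membership.Propositional.Properties using (∈-filter⁻)
open import Data.List.Relation.Unary.All as All using (All; _∷_)
open import Data.List.Relation.Unary.AllPairs using (_∷_)
open import Data.List.Relation.Unary.Any using (here; there)
open import Data.List.Relation.Unary.Unique.Propositional using (Unique)
open import Data.List.Relation.Unary.Unique.Propositional.Properties using (filter⁺)
open import Data.Nat as ℕ using (ℕ; zero; suc; _≤_; z≤n; s≤s)
import Data.Nat.Properties as ℕP
open import Algebra.Properties.CommutativeSemigroup ℕP.+-commutativeSemigroup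
  using (interchange)
open import Data.Product using (_×_; _,_; ∃; ∃₂; proj₁; proj₂)
open import Data.Product.Relation.Binary.Lex.NonStrict using (×-Lex; ×-totalOrder)
open import Data.Sign as Sign using (Sign; opposite)
open import Data.Sum as Sum using (_⊎_; inj₁; inj₂; [_,_]; [_,_]′)
open import Function using (id)
open import Relation.Binary.PropositionalEquality
  using (_≡_; _≢_; refl; sym; trans; cong; cong₂; subst; subst₂; module ≡-Reasoning)
open import Relation.Nullary using (¬_; Dec; yes; no)
open import Relation.Nullary.Decidable using (recompute)

module _ {P : Vertex → Set} {E : Vertex → Vertex → Set} where

  walk-source : ∀ {u v n} → Walk P E u v n → P u
  walk-source (stop pu)     = pu
  walk-source (step pu _ _) = pu

  walk-++ : ∀ {u v w m n} → Walk P E u v m → Walk P E v w n → Walk P E u w (m ℕ.+ n)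
  walk-++ (stop _)        w₂ = w₂
  walk-++ (step pu e w₁) w₂ = step pu e (walk-++ w₁ w₂)

  walk-reverse : (∀ x y → E x y → E y x) →
                 ∀ {u v n} → Walk P E u v n → Walk P E v u n
  walk-reverse sym-E (stop pu) = stop pu
  walk-reverse sym-E {n = suc n} (step pu e w) =
    subst (Walk P E _ _) (ℕP.+-comm n 1)
      (walk-++ (walk-reverse sym-E w) (step (walk-source w) (sym-E _ _ e) (stop pu)))

walk-map : ∀ {P Q : Vertex → Set} {E F : Vertex → Vertex → Set} →
           (∀ x → P x → Q x) → (∀ x y → E x y → F x y) →
           ∀ {u v n} → Walk P E u v n → Walk Q F u v n
walk-map P⇒Q E⇒F (stop {u} pu)         = stop (P⇒Q u pu)
walk-map P⇒Q E⇒F (step {u} {v} pu e w) = step (P⇒Q u pu) (E⇒F u v e) (walk-map P⇒Q E⇒F w)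

Adj-sym : ∀ {u v} → Adj u v → Adj v u
Adj-sym {u} {v} (inj₁ (dx , ey , ek)) =
  inj₁ (trans (ℤP.∣i-j∣≡∣j-i∣ (X v) (X u)) dx , sym ey , sym ek)
Adj-sym {u} {v} (inj₂ (inj₁ (ex , dy , ek))) =
  inj₂ (inj₁ (sym ex , trans (ℤP.∣i-j∣≡∣j-i∣ (Y v) (Y u)) dy , sym ek))
Adj-sym {u} {v} (inj₂ (inj₂ (dx , dy , dk))) =
  inj₂ (inj₂ ( trans (ℤP.∣i-j∣≡∣j-i∣ (X v) (X u)) dx
             , trans (ℤP.∣i-j∣≡∣j-i∣ (Y v) (Y u)) dy
             , trans (ℤP.∣i-j∣≡∣j-i∣ (k v) (k u)) dk))

connected-by-hub : ∀ {T : Vertex → Set} {h} →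
                   (∀ {q} → T q → ∃ λ n → Walk T Adj q h n) → InducedConnected T
connected-by-hub to-hub u v tu tv =
  _ , walk-++ (proj₂ (to-hub {u} tu))
              (walk-reverse (λ x y → Adj-sym {x} {y}) (proj₂ (to-hub {v} tv)))

vertex-ext : ∀ {u v} → X u ≡ X v → Y u ≡ Y v → k u ≡ k v → u ≡ v
vertex-ext {vtx _ _ _ _ _} {vtx _ _ _ _ _} refl refl refl = refl

_≟_ : (u v : Vertex) → Dec (u ≡ v)
u ≟ v with X u ℤ.≟ X v | Y u ℤ.≟ Y v | k u ℤ.≟ k v
... | yes ex | yes ey | yes ek = yes (vertex-ext ex ey ek)
... | no ¬ex | _      | _      = no λ u≡v → ¬ex (cong X u≡v)
... | yes _  | no ¬ey | _      = no λ u≡v → ¬ey (cong Y u≡v)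
... | yes _  | yes _  | no ¬ek = no λ u≡v → ¬ek (cong k u≡v)

open import Data.List.Membership.DecPropositional _≟_ using (_∈?_)

even-shift : ∀ {x c} m → + 2 Unsigned.∣ x - c →
             + 2 Unsigned.∣ (x + + 2 * m) - c
even-shift {x} {c} m 2∣x-c with Signed.∣ᵤ⇒∣ {+ 2} {x - c} 2∣x-c
... | Signed.divides q eq = Signed.∣⇒∣ᵤ (Signed.divides (q + m) (begin
  (x + + 2 * m) - c   ≡⟨ regroup x c m ⟩
  (x - c) + m * + 2   ≡⟨ cong (_+ m * + 2) eq ⟩
  q * + 2 + m * + 2   ≡⟨ ℤP.*-distribʳ-+ (+ 2) q m ⟨
  (q + m) * + 2       ∎))
  where
  open ≡-Reasoning
  regroup : ∀ x c m → (x + + 2 * m) - c ≡ (x - c) + m * + 2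
  regroup = solve-∀

-- p + (m, n) in grid units; the stored coordinates are doubled.
move : Vertex → ℤ → ℤ → Vertex
move (vtx x y c px py) m n =
  vtx (x + + 2 * m) (y + + 2 * n) c (even-shift {x} {c} m px) (even-shift {y} {c} n py)

move-zero : ∀ p → move p 0ℤ 0ℤ ≡ p
move-zero p = vertex-ext (ℤP.+-identityʳ (X p)) (ℤP.+-identityʳ (Y p)) refl

move-move : ∀ p m n m′ n′ → move (move p m n) m′ n′ ≡ move p (m + m′) (n + n′)
move-move p m n m′ n′ = vertex-ext (shifts (X p) m m′) (shifts (Y p) n n′) refl
  where
  shifts : ∀ x a b → (x + + 2 * a) + + 2 * b ≡ x + + 2 * (a + b)
  shifts = solve-∀

unit : Sign → ℤ
unit Sign.+ = 1ℤ
unit Sign.- = -1ℤ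

∣0-unit∣ : ∀ s → ∣ 0ℤ - unit s ∣ ≡ 1
∣0-unit∣ Sign.+ = refl
∣0-unit∣ Sign.- = refl

unit-close : ∀ s s′ → ∣ unit s′ - unit s ∣ ≤ 1 → s′ ≡ s
unit-close Sign.+ Sign.+ _ = refl
unit-close Sign.- Sign.- _ = refl
unit-close Sign.+ Sign.- (s≤s ())
unit-close Sign.- Sign.+ (s≤s ())

sign-cases : ∀ s s′ → s′ ≡ s ⊎ s′ ≡ opposite s
sign-cases Sign.+ Sign.+ = inj₁ refl
sign-cases Sign.+ Sign.- = inj₂ refl
sign-cases Sign.- Sign.+ = inj₂ refl
sign-cases Sign.- Sign.- = inj₁ refl

∣shift-diff∣ : ∀ x a b → ∣ (x + + 2 * a) - (x + + 2 * b) ∣ ≡ 2 ℕ.* ∣ a - b ∣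
∣shift-diff∣ x a b = trans (cong ∣_∣ (diff x a b)) (ℤP.abs-* (+ 2) (a - b))
  where
  diff : ∀ x a b → (x + + 2 * a) - (x + + 2 * b) ≡ + 2 * (a - b)
  diff = solve-∀

∣shift∣ : ∀ x a → ∣ x - (x + + 2 * a) ∣ ≡ 2 ℕ.* ∣ a ∣
∣shift∣ x a = begin
  ∣ x - (x + + 2 * a) ∣  ≡⟨ cong ∣_∣ (diff x a) ⟩
  ∣ + 2 * (- a) ∣        ≡⟨ ℤP.abs-* (+ 2) (- a) ⟩
  2 ℕ.* ∣ - a ∣          ≡⟨ cong (2 ℕ.*_) (ℤP.∣-i∣≡∣i∣ a) ⟩
  2 ℕ.* ∣ a ∣            ∎
  where
  open ≡-Reasoning
  diff : ∀ x a → x - (x + + 2 * a) ≡ + 2 * (- a)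
  diff = solve-∀

adj-horizontal : ∀ p m m′ n → ∣ m - m′ ∣ ≡ 1 → Adj (move p m n) (move p m′ n)
adj-horizontal p m m′ n d =
  inj₁ (trans (∣shift-diff∣ (X p) m m′) (cong (2 ℕ.*_) d) , refl , refl)

adj-vertical : ∀ p m n n′ → ∣ n - n′ ∣ ≡ 1 → Adj (move p m n) (move p m n′)
adj-vertical p m n n′ d =
  inj₂ (inj₁ (refl , trans (∣shift-diff∣ (Y p) n n′) (cong (2 ℕ.*_) d) , refl))

data GridStep (u : Vertex) : Vertex → Set where
  horizontal : ∀ s → GridStep u (move u (unit s) 0ℤ)
  vertical   : ∀ s → GridStep u (move u 0ℤ (unit s))

data Diagonal (u : Vertex) : Vertex → Set where
  diagonal : ∀ s t → Diagonal u (move u (unit s) (unit t))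

∣shift-unit∣ : ∀ x s → ∣ x - (x + + 2 * unit s) ∣ ≡ 2
∣shift-unit∣ x Sign.+ = ∣shift∣ x 1ℤ
∣shift-unit∣ x Sign.- = ∣shift∣ x -1ℤ

gridStep⇒sameLayerNbr : ∀ {u w} → GridStep u w → SameLayerNbr u w
gridStep⇒sameLayerNbr {u} (horizontal s) =
  inj₁ (∣shift-unit∣ (X u) s , sym (ℤP.+-identityʳ (Y u)) , refl) , refl
gridStep⇒sameLayerNbr {u} (vertical s) =
  inj₂ (inj₁ (sym (ℤP.+-identityʳ (X u)) , ∣shift-unit∣ (Y u) s , refl)) , refl

diagonal⇒corner : ∀ {p q} → Diagonal p q → Corner p q
diagonal⇒corner {p} (diagonal s t) = ∣shift-unit∣ (X p) s , ∣shift-unit∣ (Y p) t , refl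

abs≡2 : ∀ {z} → ∣ z ∣ ≡ 2 → ∃ λ s → z ≡ - (+ 2 * unit s)
abs≡2 {+ _}       refl = Sign.- , refl
abs≡2 { -[1+ _ ]} refl = Sign.+ , refl

difference⇒shift : ∀ a b m → a - b ≡ - (+ 2 * m) → b ≡ a + + 2 * m
difference⇒shift a b m a-b≡ = begin
  b                    ≡⟨ sub-sub a b ⟨
  a - (a - b)          ≡⟨ cong (λ z → a - z) a-b≡ ⟩
  a - - (+ 2 * m)      ≡⟨ cong (λ z → a + z) (ℤP.neg-involutive _) ⟩
  a + + 2 * m          ∎
  where
  open ≡-Reasoning
  sub-sub : ∀ a b → a - (a - b) ≡ b
  sub-sub = solve-∀

offset-by-unit : ∀ a b → ∣ a - b ∣ ≡ 2 → ∃ λ s → b ≡ a + + 2 * unit s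
offset-by-unit a b d = let s , a-b≡ = abs≡2 d in s , difference⇒shift a b (unit s) a-b≡

no-shift : ∀ {a b} → a ≡ b → b ≡ a + + 2 * 0ℤ
no-shift {a} refl = sym (ℤP.+-identityʳ a)

same-layer-not-vertical : ∀ {a b} → a ≡ b → ∣ a - b ∣ ≢ 1
same-layer-not-vertical {a} refl d with trans (sym (cong ∣_∣ (ℤP.+-inverseʳ a))) d
... | ()

sameLayerNbr⇒gridStep : ∀ {u w} → SameLayerNbr u w → GridStep u w
sameLayerNbr⇒gridStep {u} {w} (inj₁ (dx , ey , ek) , _) with offset-by-unit (X u) (X w) dx
... | s , ex = subst (GridStep u) (vertex-ext (sym ex) (sym (no-shift ey)) ek) (horizontal s)
sameLayerNbr⇒gridStep {u} {w} (inj₂ (inj₁ (ex , dy , ek)) , _) with offset-by-unit (Y u) (Y w) dy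
... | s , ey = subst (GridStep u) (vertex-ext (sym (no-shift ex)) (sym ey) ek) (vertical s)
sameLayerNbr⇒gridStep (inj₂ (inj₂ (_ , _ , dk)) , ek) = ⊥-elim (same-layer-not-vertical ek dk)

corner⇒diagonal : ∀ {p q} → Corner p q → Diagonal p q
corner⇒diagonal {p} {q} (dx , dy , ek)
  with offset-by-unit (X p) (X q) dx | offset-by-unit (Y p) (Y q) dy
... | s , ex | t , ey = subst (Diagonal p) (vertex-ext (sym ex) (sym ey) ek) (diagonal s t)

-- The doubled ℓ¹ distance within a layer

dist₁ : Vertex → Vertex → ℕ
dist₁ u v = ∣ X u - X v ∣ ℕ.+ ∣ Y u - Y v ∣

dist₁-refl : ∀ u → dist₁ u u ≡ 0
dist₁-refl u = cong₂ ℕ._+_ (cong ∣_∣ (ℤP.+-inverseʳ (X u))) (cong ∣_∣ (ℤP.+-inverseʳ (Y u)))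

∣-∣-triangle : ∀ a b c → ∣ a - c ∣ ≤ ∣ a - b ∣ ℕ.+ ∣ b - c ∣
∣-∣-triangle a b c =
  subst (λ z → ∣ z ∣ ≤ ∣ a - b ∣ ℕ.+ ∣ b - c ∣) (telescope a b c) (ℤP.∣i+j∣≤∣i∣+∣j∣ (a - b) (b - c))
  where
  telescope : ∀ a b c → (a - b) + (b - c) ≡ a - c
  telescope = solve-∀

dist₁-triangle : ∀ u v w → dist₁ u w ≤ dist₁ u v ℕ.+ dist₁ v w
dist₁-triangle u v w = ℕP.≤-trans
  (ℕP.+-mono-≤ (∣-∣-triangle (X u) (X v) (X w)) (∣-∣-triangle (Y u) (Y v) (Y w)))
  (ℕP.≤-reflexive (interchange (∣ X u - X v ∣) (∣ X v - X w ∣) (∣ Y u - Y v ∣) (∣ Y v - Y w ∣)))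

dist₁-move : ∀ p m n → dist₁ p (move p m n) ≡ 2 ℕ.* (∣ m ∣ ℕ.+ ∣ n ∣)
dist₁-move p m n =
  trans (cong₂ ℕ._+_ (∣shift∣ (X p) m) (∣shift∣ (Y p) n)) (sym (ℕP.*-distribˡ-+ 2 ∣ m ∣ ∣ n ∣))

dist₁-move-move : ∀ p m n m′ n′ →
                  dist₁ (move p m n) (move p m′ n′) ≡ 2 ℕ.* (∣ m - m′ ∣ ℕ.+ ∣ n - n′ ∣)
dist₁-move-move p m n m′ n′ =
  trans (cong₂ ℕ._+_ (∣shift-diff∣ (X p) m m′) (∣shift-diff∣ (Y p) n n′))
        (sym (ℕP.*-distribˡ-+ 2 ∣ m - m′ ∣ ∣ n - n′ ∣))

dist₁-move-move≤⇒ : ∀ p m n m′ n′ {l} → dist₁ (move p m n) (move p m′ n′) ≤ 2 ℕ.* l →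
                    ∣ m - m′ ∣ ℕ.+ ∣ n - n′ ∣ ≤ l
dist₁-move-move≤⇒ p m n m′ n′ {l} close =
  ℕP.*-cancelˡ-≤ 2 (subst (_≤ 2 ℕ.* l) (dist₁-move-move p m n m′ n′) close)

2+n≰n : ∀ {n} → ¬ (2 ℕ.+ n ≤ n)
2+n≰n 2+n≤n = ℕP.1+n≰n (ℕP.≤-trans (ℕP.n≤1+n _) 2+n≤n)

dist₁-gridStep : ∀ {u w} → GridStep u w → dist₁ u w ≡ 2
dist₁-gridStep {u} (horizontal Sign.+) = dist₁-move u 1ℤ 0ℤ
dist₁-gridStep {u} (horizontal Sign.-) = dist₁-move u -1ℤ 0ℤ
dist₁-gridStep {u} (vertical Sign.+)   = dist₁-move u 0ℤ 1ℤ
dist₁-gridStep {u} (vertical Sign.-)   = dist₁-move u 0ℤ -1ℤ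

module _ {i : ℤ} where

  walk-dist₁ : ∀ {u v n} → Walk (InLayer i) Adj u v n → dist₁ u v ≤ 2 ℕ.* n
  walk-dist₁ {u} (stop _) = ℕP.≤-reflexive (dist₁-refl u)
  walk-dist₁ {u} {v} (step {v = w} {n = n} lu adj rest) = begin
    dist₁ u v                ≤⟨ dist₁-triangle u w v ⟩
    dist₁ u w ℕ.+ dist₁ w v  ≤⟨ ℕP.+-mono-≤ (ℕP.≤-reflexive (dist₁-gridStep first)) (walk-dist₁ rest) ⟩
    2 ℕ.+ 2 ℕ.* n            ≡⟨ ℕP.*-suc 2 n ⟨
    2 ℕ.* suc n              ∎
    where
    open ℕP.≤-Reasoning
    first : GridStep u w
    first = sameLayerNbr⇒gridStep (adj , trans lu (sym (walk-source rest)))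

  column-walk : ∀ {u} n → InLayer i u → Walk (InLayer i) Adj u (move u 0ℤ (- + n)) n
  column-walk {u} zero    lu = subst (λ z → Walk (InLayer i) Adj u z 0) (sym (move-zero u)) (stop lu)
  column-walk {u} (suc n) lu =
    step {v = move u 0ℤ -1ℤ} lu (proj₁ (gridStep⇒sameLayerNbr {u} (vertical Sign.-)))
      (subst (λ z → Walk (InLayer i) Adj (move u 0ℤ -1ℤ) z n) one-more
        (column-walk {move u 0ℤ -1ℤ} n lu))
    where
    descend : ∀ n → -1ℤ + - n ≡ - (1ℤ + n)
    descend = solve-∀
    one-more : move (move u 0ℤ -1ℤ) 0ℤ (- + n) ≡ move u 0ℤ (- + suc n)
    one-more = trans (move-move u 0ℤ -1ℤ 0ℤ (- + n)) (cong (move u 0ℤ) (descend (+ n)))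

even-difference : ∀ {a b c} → + 2 Signed.∣ (a - c) → + 2 Signed.∣ (b - c) → + 2 Signed.∣ (a - b)
even-difference {a} {b} {c} (Signed.divides q eq) (Signed.divides q′ eq′) =
  Signed.divides (q - q′) (begin
    a - b                    ≡⟨ via-c a b c ⟩
    (a - c) - (b - c)        ≡⟨ cong₂ _-_ eq eq′ ⟩
    q * + 2 - q′ * + 2       ≡⟨ factor q q′ ⟩
    (q - q′) * + 2           ∎)
  where
  open ≡-Reasoning
  via-c : ∀ a b c → a - b ≡ (a - c) - (b - c)
  via-c = solve-∀
  factor : ∀ q q′ → q * + 2 - q′ * + 2 ≡ (q - q′) * + 2
  factor = solve-∀

-- The parity fields of a vertex are irrelevant; recompute makes their consequence usable.
same-layer-even : ∀ u v → k u ≡ k v → + 2 Signed.∣ (Y u - Y v)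
same-layer-even (vtx _ yu c _ pu) (vtx _ yv c _ pv) refl =
  recompute (+ 2 Signed.∣? (yu - yv))
    (even-difference {yu} {yv} {c} (Signed.∣ᵤ⇒∣ {+ 2} {yu - c} pu) (Signed.∣ᵤ⇒∣ {+ 2} {yv - c} pv))

below⇒move : ∀ {u v} → X v ≡ X u → k u ≡ k v → Y v ℤ.< Y u → ∃ λ n → v ≡ move u 0ℤ -[1+ n ]
below⇒move {u} {v} ex ek below with same-layer-even u v ek
... | Signed.divides q eq = by-quotient q v≡
  where
  halves : ∀ q → q * + 2 ≡ - (+ 2 * (- q))
  halves = solve-∀
  v≡ : v ≡ move u 0ℤ (- q)
  v≡ = vertex-ext (trans ex (sym (ℤP.+-identityʳ (X u))))
                  (difference⇒shift (Y u) (Y v) (- q) (trans eq (halves q))) (sym ek)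
  not-above : ∀ j → .{{_ : ℤ.NonNegative (+ 2 * j)}} → v ≡ move u 0ℤ j → ⊥
  not-above j v≡ = ℤP.<⇒≱ below (subst (Y u ℤ.≤_) (sym (cong Y v≡)) (ℤP.i≤i+j (Y u) (+ 2 * j)))
  by-quotient : ∀ q → v ≡ move u 0ℤ (- q) → ∃ λ n → v ≡ move u 0ℤ -[1+ n ]
  by-quotient +[1+ n ] v≡ = n , v≡
  by-quotient (+ 0)    v≡ = ⊥-elim (not-above 0ℤ v≡)
  by-quotient -[1+ n ] v≡ = ⊥-elim (not-above +[1+ n ] v≡)

-- Consequences of isometry

module Isometric {i S E} (G : IsometricSubgraph i S E) where
  open IsometricSubgraph G

  first-step-of-geodesic : ∀ {u v n} → u ∈ S → v ∈ S →
                           Walk (InLayer i) Adj u v (suc n) → dist₁ u v ≡ 2 ℕ.* suc n →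
                           ∃ λ w → w ∈ S × GridStep u w × dist₁ w v ≤ 2 ℕ.* n
  first-step-of-geodesic {u} {v} {n} u∈S v∈S walk d =
    first-step (proj₁ (proj₂ (isometric u v u∈S v∈S (suc n)) (walk , shortest)))
    where
    shortest : ∀ m → Walk (InLayer i) Adj u v m → suc n ≤ m
    shortest m w = ℕP.*-cancelˡ-≤ 2 (subst (_≤ 2 ℕ.* m) d (walk-dist₁ w))
    first-step : Walk (_∈ S) E u v (suc n) → ∃ λ w → w ∈ S × GridStep u w × dist₁ w v ≤ 2 ℕ.* n
    first-step (step {v = w} _ e rest) =
      w , walk-source rest ,
      sameLayerNbr⇒gridStep
        (edgesAdj u w e , trans (inLayer u u∈S) (sym (inLayer w (walk-source rest)))) ,
      walk-dist₁ (walk-map inLayer edgesAdj rest)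

  diagonal-closed : ∀ {u} s t → u ∈ S → move u (unit s) (unit t) ∈ S →
                    move u (unit s) 0ℤ ∈ S ⊎ move u 0ℤ (unit t) ∈ S
  diagonal-closed {u} s t u∈S v∈S =
    via-first-step (first-step-of-geodesic u∈S v∈S walk (dist₁-diagonal s t))
    where
    lu : InLayer i u
    lu = inLayer u u∈S
    walk : Walk (InLayer i) Adj u (move u (unit s) (unit t)) 2
    walk = step {v = move u (unit s) 0ℤ} lu (proj₁ (gridStep⇒sameLayerNbr {u} (horizontal s)))
             (step lu (adj-vertical u (unit s) 0ℤ (unit t) (∣0-unit∣ t)) (stop lu))
    dist₁-diagonal : ∀ s t → dist₁ u (move u (unit s) (unit t)) ≡ 4
    dist₁-diagonal Sign.+ Sign.+ = dist₁-move u 1ℤ 1ℤ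
    dist₁-diagonal Sign.+ Sign.- = dist₁-move u 1ℤ -1ℤ
    dist₁-diagonal Sign.- Sign.+ = dist₁-move u -1ℤ 1ℤ
    dist₁-diagonal Sign.- Sign.- = dist₁-move u -1ℤ -1ℤ
    via-first-step : (∃ λ w → w ∈ S × GridStep u w × dist₁ w (move u (unit s) (unit t)) ≤ 2) →
                     move u (unit s) 0ℤ ∈ S ⊎ move u 0ℤ (unit t) ∈ S
    via-first-step (_ , w∈S , horizontal s′ , close) =
      inj₁ (subst (λ r → move u (unit r) 0ℤ ∈ S) s′≡s w∈S)
      where
      s′≡s : s′ ≡ s
      s′≡s = unit-close s s′
        (ℕP.m+n≤o⇒m≤o _ (dist₁-move-move≤⇒ u (unit s′) 0ℤ (unit s) (unit t) {1} close))
    via-first-step (_ , w∈S , vertical t′ , close) =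
      inj₂ (subst (λ r → move u 0ℤ (unit r) ∈ S) t′≡t w∈S)
      where
      t′≡t : t′ ≡ t
      t′≡t = unit-close t t′
        (ℕP.m+n≤o⇒n≤o _ (dist₁-move-move≤⇒ u 0ℤ (unit t′) (unit s) (unit t) {1} close))

  below-closed : ∀ {u} n → u ∈ S → move u 0ℤ -[1+ n ] ∈ S → move u 0ℤ -1ℤ ∈ S
  below-closed {u} n u∈S v∈S = via-first-step
    (first-step-of-geodesic u∈S v∈S (column-walk (suc n) (inLayer u u∈S)) (dist₁-move u 0ℤ -[1+ n ]))
    where
    via-first-step : (∃ λ w → w ∈ S × GridStep u w × dist₁ w (move u 0ℤ -[1+ n ]) ≤ 2 ℕ.* n) →
                     move u 0ℤ -1ℤ ∈ S
    via-first-step (_ , w∈S , vertical Sign.- , _) = w∈S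
    via-first-step (_ , _ , vertical Sign.+ , close) =
      ⊥-elim (2+n≰n (dist₁-move-move≤⇒ u 0ℤ 1ℤ 0ℤ -[1+ n ] {n} close))
    via-first-step (_ , _ , horizontal Sign.+ , close) =
      ⊥-elim (2+n≰n (dist₁-move-move≤⇒ u 1ℤ 0ℤ 0ℤ -[1+ n ] {n} close))
    via-first-step (_ , _ , horizontal Sign.- , close) =
      ⊥-elim (2+n≰n (dist₁-move-move≤⇒ u -1ℤ 0ℤ 0ℤ -[1+ n ] {n} close))

  column-descent : ∀ {u v} → u ∈ S → v ∈ S → X v ≡ X u → Y v ℤ.< Y u → move u 0ℤ -1ℤ ∈ S
  column-descent {u} {v} u∈S v∈S ex below =
    let n , v≡ = below⇒move {u} {v} ex (trans (inLayer u u∈S) (sym (inLayer v v∈S))) below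
    in below-closed n u∈S (subst (_∈ S) v≡ v∈S)

-- Lexicographically extremal vertices

_·_ : Sign → ℤ → ℤ
Sign.+ · x = x
Sign.- · x = - x

·-injective : ∀ s {x y} → s · x ≡ s · y → x ≡ y
·-injective Sign.+ eq = eq
·-injective Sign.- eq = ℤP.neg-injective eq

·-move : ∀ s x → s · (x + + 2 * unit s) ≡ s · x + + 2
·-move Sign.+ x = refl
·-move Sign.- x = ℤP.neg-distrib-+ x -[1+ 1 ]

x+2≰x : ∀ x → ¬ (x + + 2 ℤ.≤ x)
x+2≰x x = ℤP.<⇒≱ (subst (ℤ._< x + + 2) (ℤP.+-identityʳ x) (ℤP.+-monoʳ-< x (ℤ.+<+ (s≤s z≤n))))

x+2*unit≢x : ∀ s x → x + + 2 * unit s ≢ x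
x+2*unit≢x s x eq = x+2≰x (s · x) (ℤP.≤-reflexive (trans (sym (·-move s x)) (cong (s ·_) eq)))

record Extremal (S : List Vertex) (s t : Sign) (p : Vertex) : Set where
  field
    member     : p ∈ S
    column-max : ∀ {q} → q ∈ S → s · X q ℤ.≤ s · X p
    row-max    : ∀ {q} → q ∈ S → X q ≡ X p → t · Y q ℤ.≤ t · Y p
open Extremal

extremal-exists : ∀ s t x xs → ∃ (Extremal (x ∷ xs) s t)
extremal-exists s t x xs = p , record
  { member     = member-p
  ; column-max = λ q∈ → column (key≤ q∈)
  ; row-max    = λ q∈ eq → row (key≤ q∈) (cong (s ·_) eq)
  }
  where
  open Data.List.Extrema (×-totalOrder ℤP.≤-decTotalOrder ℤP.≤-totalOrder)
  key : Vertex → ℤ × ℤ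
  key q = s · X q , t · Y q
  p = argmax key x xs
  member-p : p ∈ x ∷ xs
  member-p = [ here , there ]′ (argmax-sel key x xs)
  _≤ₗₑₓ_ : ℤ × ℤ → ℤ × ℤ → Set
  _≤ₗₑₓ_ = ×-Lex _≡_ ℤ._≤_ ℤ._≤_
  key≤ : ∀ {q} → q ∈ x ∷ xs → key q ≤ₗₑₓ key p
  key≤ (here refl) = f[⊥]≤f[argmax] {f = key} x xs
  key≤ (there q∈)  = All.lookup (f[xs]≤f[argmax] {f = key} x xs) q∈
  column : ∀ {a b c d} → (a , b) ≤ₗₑₓ (c , d) → a ℤ.≤ c
  column (inj₁ (a≤c , _)) = a≤c
  column (inj₂ (refl , _)) = ℤP.≤-refl
  row : ∀ {a b c d} → (a , b) ≤ₗₑₓ (c , d) → a ≡ c → b ℤ.≤ d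
  row (inj₁ (_ , a≢c)) a≡c = ⊥-elim (a≢c a≡c)
  row (inj₂ (_ , b≤d)) _   = b≤d

module _ {S s t p} (ext : Extremal S s t p) where

  outward-column-∉ : ∀ n → move p (unit s) n ∉ S
  outward-column-∉ n q∈S =
    x+2≰x (s · X p) (subst (ℤ._≤ s · X p) (·-move s (X p)) (column-max ext q∈S))

  outward-row-∉ : move p 0ℤ (unit t) ∉ S
  outward-row-∉ q∈S =
    x+2≰x (t · Y p) (subst (ℤ._≤ t · Y p) (·-move t (Y p)) (row-max ext q∈S (ℤP.+-identityʳ (X p))))

  extremal-same-column : ∀ {t′ q} → Extremal S s t′ q → X q ≡ X p
  extremal-same-column ext′ =
    ·-injective s (ℤP.≤-antisym (column-max ext (member ext′)) (column-max ext′ (member ext)))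

-- The neighbourhood of an extremal vertex

no-three-in-two : ∀ {A : Set} {a b x y z : A} →
                  x ≡ a ⊎ x ≡ b → y ≡ a ⊎ y ≡ b → z ≡ a ⊎ z ≡ b →
                  x ≢ y → x ≢ z → y ≢ z → ⊥
no-three-in-two (inj₁ refl) (inj₁ refl) _           x≢y _   _   = x≢y refl
no-three-in-two (inj₂ refl) (inj₂ refl) _           x≢y _   _   = x≢y refl
no-three-in-two (inj₁ refl) (inj₂ refl) (inj₁ refl) _   x≢z _   = x≢z refl
no-three-in-two (inj₁ refl) (inj₂ refl) (inj₂ refl) _   _   y≢z = y≢z refl
no-three-in-two (inj₂ refl) (inj₁ refl) (inj₁ refl) _   _   y≢z = y≢z refl
no-three-in-two (inj₂ refl) (inj₁ refl) (inj₂ refl) _   x≢z _   = x≢z refl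

unique-two-valued⇒length≤2 : ∀ {A : Set} {a b : A} {xs} →
                              Unique xs → All (λ x → x ≡ a ⊎ x ≡ b) xs → length xs ≤ 2
unique-two-valued⇒length≤2 {xs = []}             _ _ = z≤n
unique-two-valued⇒length≤2 {xs = _ ∷ []}         _ _ = s≤s z≤n
unique-two-valued⇒length≤2 {xs = _ ∷ _ ∷ []}     _ _ = s≤s (s≤s z≤n)
unique-two-valued⇒length≤2 {xs = _ ∷ _ ∷ _ ∷ _}
  ((x≢y ∷ x≢z ∷ _) ∷ (y≢z ∷ _) ∷ _) (x∈ ∷ y∈ ∷ z∈ ∷ _) =
  ⊥-elim (no-three-in-two x∈ y∈ z∈ x≢y x≢z y≢z)

length-N0≤2 : ∀ {S p a b} → Unique S →
              (∀ {q} → q ∈ S → SameLayerNbr p q → q ≡ a ⊎ q ≡ b) → length (N0 S p) ≤ 2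
length-N0≤2 {S} {p} unique inward =
  unique-two-valued⇒length≤2 (filter⁺ (sameLayerNbr? p) unique)
    (All.tabulate λ q∈N0 →
      let q∈S , nbr = ∈-filter⁻ (sameLayerNbr? p) {xs = S} q∈N0 in inward q∈S nbr)

InnerCornerMissing : List Vertex → Sign → Sign → Vertex → Set
InnerCornerMissing S s t p =
    move p (unit (opposite s)) 0ℤ ∈ S
  × move p 0ℤ (unit (opposite t)) ∈ S
  × move p (unit (opposite s)) (unit (opposite t)) ∉ S

module Neighbourhood {i S E} (G : IsometricSubgraph i S E) (unique : Unique S)
                     {s t p} (ext : Extremal S s t p) where
  open Isometric G

  s̄ t̄ : Sign
  s̄ = opposite s
  t̄ = opposite t

  a b c d : Vertex
  a = move p (unit s̄) 0ℤ
  b = move p 0ℤ (unit t̄)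
  c = move p (unit s̄) (unit t̄)
  d = move p (unit s̄) (unit t)

  horizontal-inward : ∀ s′ → s′ ≡ s ⊎ s′ ≡ s̄ → move p (unit s′) 0ℤ ∈ S →
                      move p (unit s′) 0ℤ ≡ a
  horizontal-inward _ (inj₁ refl) q∈S = ⊥-elim (outward-column-∉ ext 0ℤ q∈S)
  horizontal-inward _ (inj₂ refl) _   = refl

  vertical-inward : ∀ t′ → t′ ≡ t ⊎ t′ ≡ t̄ → move p 0ℤ (unit t′) ∈ S →
                    move p 0ℤ (unit t′) ≡ b
  vertical-inward _ (inj₁ refl) q∈S = ⊥-elim (outward-row-∉ ext q∈S)
  vertical-inward _ (inj₂ refl) _   = refl

  diagonal-inward : ∀ s′ t′ → s′ ≡ s ⊎ s′ ≡ s̄ → t′ ≡ t ⊎ t′ ≡ t̄ →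
                    move p (unit s′) (unit t′) ∈ S →
                    move p (unit s′) (unit t′) ≡ c ⊎ move p (unit s′) (unit t′) ≡ d
  diagonal-inward _ t′ (inj₁ refl) _           q∈S = ⊥-elim (outward-column-∉ ext (unit t′) q∈S)
  diagonal-inward _ _  (inj₂ refl) (inj₁ refl) _   = inj₂ refl
  diagonal-inward _ _  (inj₂ refl) (inj₂ refl) _   = inj₁ refl

  gridStep-inward : ∀ {q} → q ∈ S → GridStep p q → q ≡ a ⊎ q ≡ b
  gridStep-inward q∈S (horizontal s′) = inj₁ (horizontal-inward s′ (sign-cases s s′) q∈S)
  gridStep-inward q∈S (vertical t′)   = inj₂ (vertical-inward t′ (sign-cases t t′) q∈S)

  N⁰-inward : ∀ {q} → q ∈ S → SameLayerNbr p q → q ≡ a ⊎ q ≡ b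
  N⁰-inward q∈S nbr = gridStep-inward q∈S (sameLayerNbr⇒gridStep nbr)

  M-inward : ∀ {q} → InM S p q → q ≡ a ⊎ q ≡ b ⊎ q ≡ c ⊎ q ≡ d
  M-inward (q∈S , inj₁ nbr) = Sum.map₂ inj₁ (N⁰-inward q∈S nbr)
  M-inward {q} (q∈S , inj₂ corner) = corner-inward q∈S (corner⇒diagonal {p} {q} corner)
    where
    corner-inward : ∀ {q} → q ∈ S → Diagonal p q → q ≡ a ⊎ q ≡ b ⊎ q ≡ c ⊎ q ≡ d
    corner-inward q∈S (diagonal s′ t′) =
      inj₂ (inj₂ (diagonal-inward s′ t′ (sign-cases s s′) (sign-cases t t′) q∈S))

  d∈S⇒a∈S : d ∈ S → a ∈ S
  d∈S⇒a∈S d∈S = [ id , (λ outward∈S → ⊥-elim (outward-row-∉ ext outward∈S)) ]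
                   (diagonal-closed s̄ t (member ext) d∈S)

  c∈S⇒a∈S⊎b∈S : c ∈ S → a ∈ S ⊎ b ∈ S
  c∈S⇒a∈S⊎b∈S = diagonal-closed s̄ t̄ (member ext)

  c~a : Adj c a
  c~a = Adj-sym {a} {c} (adj-vertical p (unit s̄) 0ℤ (unit t̄) (∣0-unit∣ t̄))

  b~c : Adj b c
  b~c = adj-horizontal p 0ℤ (unit s̄) (unit t̄) (∣0-unit∣ s̄)

  d~a : Adj d a
  d~a = Adj-sym {a} {d} (adj-vertical p (unit s̄) 0ℤ (unit t) (∣0-unit∣ t))

  M-connected-via-a : a ∈ S → (b ∈ S → c ∈ S) → InducedConnected (InM S p)
  M-connected-via-a a∈S b⇒c = connected-by-hub (λ Mq → to-a Mq (M-inward Mq))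
    where
    Ma : InM S p a
    Ma = a∈S , inj₁ (gridStep⇒sameLayerNbr {p} (horizontal s̄))
    to-a : ∀ {q} → InM S p q → q ≡ a ⊎ q ≡ b ⊎ q ≡ c ⊎ q ≡ d →
           ∃ λ n → Walk (InM S p) Adj q a n
    to-a _  (inj₁ refl)               = _ , stop Ma
    to-a Mb (inj₂ (inj₁ refl))        =
      let Mc = b⇒c (proj₁ Mb) , inj₂ (diagonal⇒corner {p} (diagonal s̄ t̄))
      in _ , step Mb b~c (step Mc c~a (stop Ma))
    to-a Mc (inj₂ (inj₂ (inj₁ refl))) = _ , step Mc c~a (stop Ma)
    to-a Md (inj₂ (inj₂ (inj₂ refl))) = _ , step Md d~a (stop Ma)

  M-connected-via-b : a ∉ S → InducedConnected (InM S p)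
  M-connected-via-b a∉S = connected-by-hub (λ Mq → to-b Mq (M-inward Mq))
    where
    Mb-of-c : c ∈ S → InM S p b
    Mb-of-c c∈S =
      [ (λ a∈S → ⊥-elim (a∉S a∈S)) , (λ b∈S → b∈S , inj₁ (gridStep⇒sameLayerNbr {p} (vertical t̄))) ]
        (c∈S⇒a∈S⊎b∈S c∈S)
    to-b : ∀ {q} → InM S p q → q ≡ a ⊎ q ≡ b ⊎ q ≡ c ⊎ q ≡ d →
           ∃ λ n → Walk (InM S p) Adj q b n
    to-b Ma (inj₁ refl)               = ⊥-elim (a∉S (proj₁ Ma))
    to-b Mb (inj₂ (inj₁ refl))        = _ , stop Mb
    to-b Mc (inj₂ (inj₂ (inj₁ refl))) =
      _ , step Mc (Adj-sym {b} {c} b~c) (stop (Mb-of-c (proj₁ Mc)))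
    to-b Md (inj₂ (inj₂ (inj₂ refl))) = ⊥-elim (a∉S (d∈S⇒a∈S (proj₁ Md)))

  N⁰-length≤2 : length (N0 S p) ≤ 2
  N⁰-length≤2 = length-N0≤2 {S} {p} {a} {b} unique N⁰-inward

  good⊎innerCornerMissing : Good S p ⊎ InnerCornerMissing S s t p
  good⊎innerCornerMissing = decide (a ∈? S) (b ∈? S) (c ∈? S)
    where
    decide : Dec (a ∈ S) → Dec (b ∈ S) → Dec (c ∈ S) → Good S p ⊎ InnerCornerMissing S s t p
    decide (yes a∈S) (yes b∈S) (no c∉S)  = inj₂ (a∈S , b∈S , c∉S)
    decide (yes a∈S) (yes _)   (yes c∈S) =
      inj₁ (M-connected-via-a a∈S (λ _ → c∈S) , N⁰-length≤2)
    decide (yes a∈S) (no b∉S)  _         =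
      inj₁ (M-connected-via-a a∈S (λ b∈S → ⊥-elim (b∉S b∈S)) , N⁰-length≤2)
    decide (no a∉S)  _         _         = inj₁ (M-connected-via-b a∉S , N⁰-length≤2)

OneColumn : List Vertex → Set
OneColumn S = ∀ {r r′} → r ∈ S → r′ ∈ S → X r ≡ X r′

extremes-meet⇒oneColumn : ∀ {S t t′ p q} → Extremal S Sign.+ t p → Extremal S Sign.- t′ q →
                          X p ≡ X q → OneColumn S
extremes-meet⇒oneColumn {S} {p = p} right left meet r∈S r′∈S =
  trans (in-column r∈S) (sym (in-column r′∈S))
  where
  in-column : ∀ {r} → r ∈ S → X r ≡ X p
  in-column {r} r∈S = ℤP.≤-antisym (column-max right r∈S)
    (subst (ℤ._≤ X r) (sym meet) (ℤP.neg-cancel-≤ (column-max left r∈S)))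

module TwoGood {i S E} (G : IsometricSubgraph i S E) (unique : Unique S) where
  open IsometricSubgraph G
  open Isometric G

  open module N {s t p} (ext : Extremal S s t p) = Neighbourhood G unique ext
    using (good⊎innerCornerMissing)

  good-in-extreme-column : ∀ {s p q} → Extremal S s Sign.+ p → Extremal S s Sign.- q →
                           ∃ λ g → g ∈ S × Good S g × X g ≡ X p
  good-in-extreme-column {s} {p} {q} top bottom =
    choose (good⊎innerCornerMissing top) (good⊎innerCornerMissing bottom)
    where
    s̄ = opposite s
    same-column : X q ≡ X p
    same-column = extremal-same-column top bottom
    below-top : move p 0ℤ -1ℤ ∈ S → Y q ℤ.< Y p
    below-top b∈S = ℤP.≤-<-trans
      (ℤP.neg-cancel-≤ (row-max bottom b∈S (trans (ℤP.+-identityʳ (X p)) (sym same-column))))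
      (subst (Y p + + 2 * -1ℤ ℤ.<_) (ℤP.+-identityʳ (Y p)) (ℤP.+-monoʳ-< (Y p) ℤ.-<+))
    corner : move (move p (unit s̄) 0ℤ) 0ℤ -1ℤ ≡ move p (unit s̄) -1ℤ
    corner = trans (move-move p (unit s̄) 0ℤ 0ℤ -1ℤ)
                   (cong₂ (move p) (ℤP.+-identityʳ (unit s̄)) (ℤP.+-identityˡ -1ℤ))
    choose : Good S p ⊎ InnerCornerMissing S s Sign.+ p →
             Good S q ⊎ InnerCornerMissing S s Sign.- q →
             ∃ λ g → g ∈ S × Good S g × X g ≡ X p
    choose (inj₁ good) _           = p , member top , good , refl
    choose (inj₂ _)    (inj₁ good) = q , member bottom , good , same-column
    choose (inj₂ (a∈S , b∈S , c∉S)) (inj₂ (a′∈S , _ , _)) =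
      ⊥-elim (c∉S (subst (_∈ S) corner
        (column-descent a∈S a′∈S (cong (_+ + 2 * unit s̄) same-column)
          (subst₂ ℤ._<_ (sym (ℤP.+-identityʳ (Y q))) (sym (ℤP.+-identityʳ (Y p))) (below-top b∈S)))))

  oneColumn⇒good : ∀ {s t p} → OneColumn S → Extremal S s t p → Good S p
  oneColumn⇒good {s} {p = p} column ext =
    [ id , (λ (a∈S , _) → ⊥-elim (x+2*unit≢x (opposite s) (X p) (column a∈S (member ext)))) ]′
      (good⊎innerCornerMissing ext)

  top≢bottom : ∀ {s p q x y} → OneColumn S → Extremal S s Sign.+ p → Extremal S s Sign.- q →
               x ∈ S → y ∈ S → x ≢ y → p ≢ q
  top≢bottom {p = p} column top bottom x∈S y∈S x≢y refl =
    x≢y (trans (collapse x∈S) (sym (collapse y∈S)))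
    where
    collapse : ∀ {r} → r ∈ S → r ≡ p
    collapse {r} r∈S = vertex-ext Xr
      (ℤP.≤-antisym (row-max top r∈S Xr) (ℤP.neg-cancel-≤ (row-max bottom r∈S Xr)))
      (trans (inLayer r r∈S) (sym (inLayer p (member top))))
      where
      Xr : X r ≡ X p
      Xr = column r∈S (member top)

  two-good-vertices : ∀ {x y} → x ∈ S → y ∈ S → x ≢ y → ∀ {p₊ q₊ p₋ q₋} →
                      Extremal S Sign.+ Sign.+ p₊ → Extremal S Sign.+ Sign.- q₊ →
                      Extremal S Sign.- Sign.+ p₋ → Extremal S Sign.- Sign.- q₋ →
                      ∃₂ λ u₊ u₋ → u₊ ≢ u₋ × u₊ ∈ S × u₋ ∈ S × Good S u₊ × Good S u₋
  two-good-vertices x∈S y∈S x≢y {p₊} {q₊} {p₋} top₊ bottom₊ top₋ bottom₋ = decide (X p₊ ℤ.≟ X p₋)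
    where
    decide : Dec (X p₊ ≡ X p₋) →
             ∃₂ λ u₊ u₋ → u₊ ≢ u₋ × u₊ ∈ S × u₋ ∈ S × Good S u₊ × Good S u₋
    decide (yes meet) =
      p₊ , q₊ , top≢bottom column top₊ bottom₊ x∈S y∈S x≢y , member top₊ , member bottom₊ ,
      oneColumn⇒good column top₊ , oneColumn⇒good column bottom₊
      where
      column : OneColumn S
      column = extremes-meet⇒oneColumn top₊ top₋ meet
    decide (no apart) =
      let g , g∈S , good-g , Xg = good-in-extreme-column top₊ bottom₊
          h , h∈S , good-h , Xh = good-in-extreme-column top₋ bottom₋
      in g , h , (λ g≡h → apart (trans (sym Xg) (trans (cong X g≡h) Xh))) , g∈S , h∈S , good-g , good-h

mainTheorem1 : (i : ℤ) (S : List Vertex) (E : Vertex → Vertex → Set) →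
               Unique S → 2 ≤ length S → IsometricSubgraph i S E →
               ∃₂ λ u₊ u₋ → u₊ ≢ u₋ × u₊ ∈ S × u₋ ∈ S × Good S u₊ × Good S u₋
mainTheorem1 i []           E _ ()  _
mainTheorem1 i (_ ∷ [])     E _ (s≤s ()) _
mainTheorem1 i (x ∷ y ∷ xs) E unique@((x≢y ∷ _) ∷ _) _ G =
  TwoGood.two-good-vertices G unique (here refl) (there (here refl)) x≢y
    (extremal Sign.+ Sign.+) (extremal Sign.+ Sign.-)
    (extremal Sign.- Sign.+) (extremal Sign.- Sign.-)
  where
  extremal : ∀ s t → Extremal (x ∷ y ∷ xs) s t (proj₁ (extremal-exists s t x (y ∷ xs)))
  extremal s t = proj₂ (extremal-exists s t x (y ∷ xs))
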